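{- The set $I(321)$ contains infinitely many simple involutions.
   Context: A permutation of length $n$ is a bijection of $\{1,\dots,n\}$ in one-line notation. A permutation avoids $321$ if it has no indices $i<j<k$ with $\pi(i)>\pi(j)>\pi(k)$. An involution satisfies $\pi(\pi(i))=i$ for all $i$. $I(321)$ is the set of involutions avoiding $321$. An interval of a permutation of length $n$ is a set of contiguous positions whose image is a set of contiguous integers; a permutation is simple if its only intervals are the empty set, singletons and $[1,n]$. -}

module Defs where

open import Data.Nat using (ℕ; zero; suc; _+_; _∸_; _≤_; _<_; _≥_)
open import Data.Fin using (Fin; toℕ)
open import Data.Product using (Σ; _×_; ∃; _,_)
open import Data.Sum using (_⊎_)
open import Relation.Binary.PropositionalEquality using (_≡_)
open import Relation.Nullary using (¬_)
open import Function.Definitions using (Bijective)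

-- A permutation of length n: a bijection of {1..n}, represented on Fin n
-- (values/positions shifted down by one, which does not affect any notion below).
record Perm (n : ℕ) : Set where
  constructor perm
  field
    fun       : Fin n → Fin n
    bijective : Bijective _≡_ _≡_ fun
open Perm public

Avoids321 : ∀ {n} → Perm n → Set
Avoids321 {n} π = ∀ (i j k : Fin n) → toℕ i < toℕ j → toℕ j < toℕ k →
  ¬ (toℕ (fun π j) < toℕ (fun π i) × toℕ (fun π k) < toℕ (fun π j))

Involution : ∀ {n} → Perm n → Set
Involution {n} π = ∀ (i : Fin n) → fun π (fun π i) ≡ i

IsInterval : ∀ {n} → Perm n → ℕ → ℕ → Set
IsInterval {n} π a b = ∃ λ c →
    (∀ (i : Fin n) → a ≤ toℕ i → toℕ i ≤ b →
       c ≤ toℕ (fun π i) × toℕ (fun π i) ≤ c + (b ∸ a))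
  × (∀ (j : Fin n) → c ≤ toℕ j → toℕ j ≤ c + (b ∸ a) →
       ∃ λ (i : Fin n) → a ≤ toℕ i × toℕ i ≤ b × fun π i ≡ j)

-- Simple: the only intervals are ∅, singletons and the whole [1,n].
-- (Position sets are subsets of {0..n-1}; the empty set is excluded by a ≤ b.)
Simple : ∀ {n} → Perm n → Set
Simple {n} π = ∀ (a b : ℕ) → a ≤ b → b < n → IsInterval π a b →
  a ≡ b ⊎ (a ≡ 0 × suc b ≡ n)

SimpleI321 : ∀ {n} → Perm n → Set
SimpleI321 π = Involution π × Avoids321 π × Simple π

module Submission where

-- A fixed-point-free involution is the same thing as a perfect matching of its
-- positions.  For an arbitrary matching (module Involution) we show:
--   * if no arc is nested inside another, the involution avoids 321: among three
--     positions two are matched in the same direction, and those keep their order;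
--   * the involution is simple as soon as adjacent positions a, a+1 always admit
--     an "escape": a position v between their partners whose own partner lies left
--     of a (resp. right of a+1).  Interval images are closed under betweenness, so
--     escapes forbid intervals of length ≥ 2 other than the whole range.
-- Adjacent positions matched in opposite directions always escape.  The zigzag
-- matching {0,2}, {2t+1,2t+4} (t ≤ m), {2m+3,2m+5} (one-line notation
-- 3 5 1 7 2 9 4 …) is non-nesting, and only the pairs (0,1) and (2m+4,2m+5) are
-- matched in the same direction; these two are handled by explicit escapes.

open import Defs
open import Data.Nat using (ℕ; zero; suc; _+_; _∸_; _≤_; _<_; _≥_; z≤n; s≤s)
open import Data.Nat.Properties
open import Data.Fin using (Fin; toℕ; fromℕ<)
open import Data.Fin.Properties using (toℕ<n; toℕ-fromℕ<; toℕ-injective)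
open import Data.Product using (Σ; ∃; ∃₂; _×_; _,_; proj₁; proj₂; swap; uncurry)
open import Data.Sum using (_⊎_; inj₁; inj₂)
open import Data.Empty using (⊥-elim)
open import Function.Consequences.Propositional
  using (inverseᵇ⇒bijective; strictlyInverseˡ⇒inverseˡ; strictlyInverseʳ⇒inverseʳ)
open import Relation.Binary.Definitions using (tri<; tri≈; tri>)
open import Relation.Binary.PropositionalEquality
open import Relation.Nullary using (¬_; yes; no)

private
  variable
    a b m p t x x' y y' z v w lo hi : ℕ

_∈[_,_] : ℕ → ℕ → ℕ → Set
z ∈[ lo , hi ] = lo ≤ z × z ≤ hi

Between : ℕ → ℕ → ℕ → Set
Between y y' v = v ∈[ y , y' ] ⊎ v ∈[ y' , y ]

between-in-range : y ∈[ lo , hi ] → y' ∈[ lo , hi ] → Between y y' v → v ∈[ lo , hi ]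
between-in-range (lo≤y , _) (_ , y'≤hi) (inj₁ (y≤v , v≤y')) =
  ≤-trans lo≤y y≤v , ≤-trans v≤y' y'≤hi
between-in-range (_ , y≤hi) (lo≤y' , _) (inj₂ (y'≤v , v≤y)) =
  ≤-trans lo≤y' y'≤v , ≤-trans v≤y y≤hi

-- A perfect matching of {0, …, n-1}: every position is an end of exactly one arc
-- (arcs are oriented, so "the left end x of an arc" means Arc x y).
record Matching (n : ℕ) : Set₁ where
  field
    Arc        : ℕ → ℕ → Set
    in-range   : Arc x y → x < n × y < n
    functional : Arc x y → Arc x y' → y ≡ y'
    injective  : Arc x y → Arc x' y → x ≡ x'
    disjoint   : Arc x y → ¬ Arc z x
    covering   : x < n → ∃ (Arc x) ⊎ ∃ λ z → Arc z x

module Involution {n : ℕ} (M : Matching n) where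
  open Matching M

  Partner : ℕ → ℕ → Set
  Partner x y = Arc x y ⊎ Arc y x

  partner-sym : Partner x y → Partner y x
  partner-sym (inj₁ r) = inj₂ r
  partner-sym (inj₂ r) = inj₁ r

  partner-functional : Partner x y → Partner x y' → y ≡ y'
  partner-functional (inj₁ r) (inj₁ r') = functional r r'
  partner-functional (inj₂ r) (inj₂ r') = injective r r'
  partner-functional (inj₁ r) (inj₂ r') = ⊥-elim (disjoint r r')
  partner-functional (inj₂ r) (inj₁ r') = ⊥-elim (disjoint r' r)

  partner-in-range : Partner x y → x < n × y < n
  partner-in-range (inj₁ r) = in-range r
  partner-in-range (inj₂ r) = swap (in-range r)

  partner-exists : x < n → ∃ (Partner x)
  partner-exists x<n with covering x<n
  ... | inj₁ (y , r) = y , inj₁ r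
  ... | inj₂ (y , r) = y , inj₂ r

  σ : Fin n → Fin n
  σ i = fromℕ< (proj₂ (partner-in-range (proj₂ (partner-exists (toℕ<n i)))))

  σ-partner : ∀ i → Partner (toℕ i) (toℕ (σ i))
  σ-partner i =
    subst (Partner (toℕ i)) (sym (toℕ-fromℕ< _)) (proj₂ (partner-exists (toℕ<n i)))

  σ-at : Partner x y → (x<n : x < n) → toℕ (σ (fromℕ< x<n)) ≡ y
  σ-at {x} r x<n = partner-functional at-x r
    where
    at-x : Partner x (toℕ (σ (fromℕ< x<n)))
    at-x = subst (λ z → Partner z (toℕ (σ (fromℕ< x<n))))
                 (toℕ-fromℕ< x<n) (σ-partner (fromℕ< x<n))

  σ-involutive : ∀ i → σ (σ i) ≡ i
  σ-involutive i =
    toℕ-injective (partner-functional (σ-partner (σ i)) (partner-sym (σ-partner i)))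

  π : Perm n
  π = perm σ (inverseᵇ⇒bijective
    (strictlyInverseˡ⇒inverseˡ σ σ-involutive , strictlyInverseʳ⇒inverseʳ σ σ-involutive))

  π-involution : Involution π
  π-involution = σ-involutive

  NonNesting : Set
  NonNesting = ∀ {x y x' y'} → Arc x y → Arc x' y' → x < x' → y < y'

  non-nesting-right : NonNesting → Arc x y → Arc x' y' → y < y' → x < x'
  non-nesting-right {x} {y} {x'} nn r r' y<y' with <-cmp x x'
  ... | tri< x<x' _ _ = x<x'
  ... | tri≈ _ refl _ = ⊥-elim (<-irrefl (functional r r') y<y')
  ... | tri> _ _ x'<x = ⊥-elim (<-asym y<y' (nn r' r x'<x))

  openers-ordered : NonNesting → Arc x y → Arc x' y' → x < x' → ¬ y' < y
  openers-ordered nn r r' x<x' = <-asym (nn r r' x<x')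

  closers-ordered : NonNesting → Arc y x → Arc y' x' → x < x' → ¬ y' < y
  closers-ordered nn r r' x<x' = <-asym (non-nesting-right nn r r' x<x')

  -- Of three positions two are matched in the same direction, so no 321 occurs.
  avoids321 : NonNesting → Avoids321 π
  avoids321 nn i j k i<j j<k (σj<σi , σk<σj) with σ-partner i | σ-partner j | σ-partner k
  ... | inj₁ ri | inj₁ rj | _       = openers-ordered nn ri rj i<j σj<σi
  ... | inj₂ ri | inj₂ rj | _       = closers-ordered nn ri rj i<j σj<σi
  ... | _       | inj₁ rj | inj₁ rk = openers-ordered nn rj rk j<k σk<σj
  ... | _       | inj₂ rj | inj₂ rk = closers-ordered nn rj rk j<k σk<σj
  ... | inj₁ ri | inj₂ _  | inj₁ rk =
    openers-ordered nn ri rk (<-trans i<j j<k) (<-trans σk<σj σj<σi)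
  ... | inj₂ ri | inj₁ _  | inj₂ rk =
    closers-ordered nn ri rk (<-trans i<j j<k) (<-trans σk<σj σj<σi)

  -- If x₁, x₂ lie in an interval [a, b], then so does the partner of every
  -- position between their partners: the image of [a, b] is a range.
  interval-closed : IsInterval π a b → ∀ {x₁ x₂ y₁ y₂} → x₁ ∈[ a , b ] → x₂ ∈[ a , b ] →
    Partner x₁ y₁ → Partner x₂ y₂ → Partner v w → Between y₁ y₂ v → w ∈[ a , b ]
  interval-closed {a} {b} (c , into , onto) x₁∈ x₂∈ r₁ r₂ r btw =
    preimage (between-in-range (image x₁∈ r₁) (image x₂∈ r₂) btw) r
    where
    d : ℕ
    d = c + (b ∸ a)

    as-position : (x<n : x < n) → x ∈[ lo , hi ] → toℕ (fromℕ< x<n) ∈[ lo , hi ]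
    as-position x<n = subst (_∈[ _ , _ ]) (sym (toℕ-fromℕ< x<n))

    image : x ∈[ a , b ] → Partner x y → y ∈[ c , d ]
    image {x} x∈ r =
      subst (_∈[ c , d ]) (σ-at r x<n) (uncurry (into (fromℕ< x<n)) (as-position x<n x∈))
      where
      x<n : x < n
      x<n = proj₁ (partner-in-range r)

    preimage : v ∈[ c , d ] → Partner v w → w ∈[ a , b ]
    preimage {v} v∈ r with uncurry (onto (fromℕ< v<n)) (as-position v<n v∈)
      where
      v<n : v < n
      v<n = proj₁ (partner-in-range r)
    ... | i , a≤i , i≤b , σi≡v =
      subst (_∈[ a , b ]) (partner-functional (partner-sym i↔v) r) (a≤i , i≤b)
      where
      i↔v : Partner (toℕ i) v
      i↔v = subst (Partner (toℕ i)) (trans (cong toℕ σi≡v) (toℕ-fromℕ< _)) (σ-partner i)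

  EscapesLeft : ℕ → ℕ → ℕ → Set
  EscapesLeft a y y' = ∃₂ λ v w → Partner v w × w < a × Between y y' v

  EscapesRight : ℕ → ℕ → ℕ → Set
  EscapesRight p y y' = ∃₂ λ v w → Partner v w × suc p < w × Between y y' v

  LeftEscape : ℕ → Set
  LeftEscape a = ∀ {y y'} → Partner a y → Partner (suc a) y' → EscapesLeft a y y'

  RightEscape : ℕ → Set
  RightEscape p = ∀ {y y'} → Partner p y → Partner (suc p) y' → EscapesRight p y y'

  interval-starts-at-0 : (∀ {a} → 1 ≤ a → LeftEscape a) →
    a < b → b < n → IsInterval π a b → a ≡ 0
  interval-starts-at-0 {zero} escape a<b b<n iv = refl
  interval-starts-at-0 {suc a} escape a<b b<n iv
    with partner-exists (<-trans a<b b<n) | partner-exists (≤-<-trans a<b b<n)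
  ... | y , r | y' , r' with escape (s≤s z≤n) r r'
  ... | v , w , rv , w<a , btw =
    ⊥-elim (<⇒≱ w<a (proj₁ (interval-closed iv (≤-refl , <⇒≤ a<b) (n≤1+n _ , a<b)
                                              r r' rv btw)))

  interval-ends-at-last : (∀ {p} → 2 + p < n → RightEscape p) →
    a < b → b < n → IsInterval π a b → suc b ≡ n
  interval-ends-at-last {b = suc p} escape a<b b<n iv with suc (suc p) ≟ n
  ... | yes b+1≡n = b+1≡n
  ... | no b+1≢n with partner-exists (<-trans (n<1+n p) b<n) | partner-exists b<n
  ... | y , r | y' , r' with escape (≤∧≢⇒< b<n b+1≢n) r r'
  ... | v , w , rv , b<w , btw =
    ⊥-elim (<⇒≱ b<w (proj₂ (interval-closed iv (≤-pred a<b , n≤1+n p) (<⇒≤ a<b , ≤-refl)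
                                              r r' rv btw)))

  simple : (∀ {a} → 1 ≤ a → LeftEscape a) → (∀ {p} → 2 + p < n → RightEscape p) → Simple π
  simple left right a b a≤b b<n iv with a ≟ b
  ... | yes a≡b = inj₁ a≡b
  ... | no a≢b =
    inj₂ (interval-starts-at-0 left a<b b<n iv , interval-ends-at-last right a<b b<n iv)
    where
    a<b : a < b
    a<b = ≤∧≢⇒< a≤b a≢b

  LongArcs : Set
  LongArcs = ∀ {x y} → Arc x y → 2 + x ≤ y

  -- Adjacent positions matched in opposite directions always escape; the
  -- escaping position is one of the two themselves.
  left-escape-opener-closer : LongArcs → Arc a y → Arc y' (suc a) → EscapesLeft a y y'
  left-escape-opener-closer long r r' =
    _ , _ , inj₂ r' , ≤-pred (long r') ,
    inj₂ (≤-trans (m≤n+m _ 2) (long r') , ≤-trans (n≤1+n _) (long r))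

  left-escape-closer-opener : LongArcs → Arc y a → Arc (suc a) y' → EscapesLeft a y y'
  left-escape-closer-opener {y} {a} long r r' =
    _ , _ , inj₂ r , y<a , inj₁ (<⇒≤ y<a , ≤-trans (m≤n+m _ 3) (long r'))
    where
    y<a : y < a
    y<a = ≤-trans (n≤1+n _) (long r)

  right-escape-opener-closer : LongArcs → Arc p y → Arc y' (suc p) → EscapesRight p y y'
  right-escape-opener-closer long r r' =
    _ , _ , inj₁ r , long r ,
    inj₂ (<⇒≤ (≤-pred (long r')) , ≤-trans (m≤n+m _ 2) (long r))

  right-escape-closer-opener : LongArcs → Arc y p → Arc (suc p) y' → EscapesRight p y y'
  right-escape-closer-opener {p = p} {y' = y'} long r r' =
    _ , _ , inj₁ r' , p+1<y' ,
    inj₁ (≤-trans (m≤n+m _ 2) (≤-trans (long r) (n≤1+n _)) , <⇒≤ p+1<y')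
    where
    p+1<y' : suc p < y'
    p+1<y' = ≤-trans (n≤1+n _) (long r')

double : ℕ → ℕ
double zero = zero
double (suc n) = suc (suc (double n))

double-injective : double a ≡ double b → a ≡ b
double-injective {zero} {zero} _ = refl
double-injective {suc a} {suc b} e = cong suc (double-injective (suc-injective (suc-injective e)))

double≢odd : double a ≢ suc (double b)
double≢odd {suc a} {suc b} e = double≢odd (suc-injective (suc-injective e))

double-mono-≤ : a ≤ b → double a ≤ double b
double-mono-≤ z≤n = z≤n
double-mono-≤ (s≤s a≤b) = s≤s (s≤s (double-mono-≤ a≤b))

double-mono-< : a < b → double a < double b
double-mono-< a<b = ≤-trans (n≤1+n _) (double-mono-≤ a<b)

double-cancel-< : double a < double b → a < b
double-cancel-< lt = ≰⇒> (λ b≤a → <⇒≱ lt (double-mono-≤ b≤a))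

n≤double : ∀ n → n ≤ double n
n≤double zero = z≤n
n≤double (suc n) = s≤s (≤-trans (n≤double n) (n≤1+n _))

data Parity : ℕ → Set where
  even : ∀ h → Parity (double h)
  odd  : ∀ h → Parity (suc (double h))

parity : ∀ x → Parity x
parity zero = even zero
parity (suc x) with parity x
... | even h = odd h
... | odd h = even (suc h)

data ZigzagArc (m x y : ℕ) : Set where
  first : x ≡ 0 → y ≡ 2 → ZigzagArc m x y
  chain : ∀ t → t ≤ m → x ≡ 1 + double t → y ≡ 4 + double t → ZigzagArc m x y
  last  : x ≡ 3 + double m → y ≡ 5 + double m → ZigzagArc m x y

chain-opener-< : t ≤ m → 1 + double t < 3 + double m
chain-opener-< t≤m = s≤s (s≤s (m≤n⇒m≤1+n (double-mono-≤ t≤m)))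

chain-closer-< : t ≤ m → 4 + double t < 5 + double m
chain-closer-< t≤m = +-monoʳ-≤ 5 (double-mono-≤ t≤m)

zigzag-long : ZigzagArc m x y → 2 + x ≤ y
zigzag-long (first refl refl) = ≤-refl
zigzag-long (chain t _ refl refl) = n≤1+n _
zigzag-long (last refl refl) = ≤-refl

zigzag-in-range : ZigzagArc m x y → x < 6 + double m × y < 6 + double m
zigzag-in-range r = <-trans (≤-trans (n≤1+n _) (zigzag-long r)) (closer-in-range r) ,
                    closer-in-range r
  where
  closer-in-range : ZigzagArc m x y → y < 6 + double m
  closer-in-range (first _ refl) = s≤s (s≤s (s≤s z≤n))
  closer-in-range (chain t t≤m _ refl) = m≤n⇒m≤1+n (chain-closer-< t≤m)
  closer-in-range (last _ refl) = ≤-refl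

zigzag-functional : ZigzagArc m x y → ZigzagArc m x y' → y ≡ y'
zigzag-functional (first refl refl) (first _ refl) = refl
zigzag-functional (first refl _) (chain _ _ () _)
zigzag-functional (first refl _) (last () _)
zigzag-functional (chain t _ refl _) (first () _)
zigzag-functional (chain t _ refl refl) (chain t' _ e refl) =
  cong (λ s → 4 + double s) (double-injective (suc-injective e))
zigzag-functional (chain t t≤m refl _) (last e _) = ⊥-elim (<-irrefl e (chain-opener-< t≤m))
zigzag-functional (last refl _) (first () _)
zigzag-functional (last refl _) (chain t t≤m e _) = ⊥-elim (<-irrefl (sym e) (chain-opener-< t≤m))
zigzag-functional (last refl refl) (last _ refl) = refl

zigzag-injective : ZigzagArc m x y → ZigzagArc m x' y → x ≡ x'
zigzag-injective (first refl refl) (first refl _) = refl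
zigzag-injective (first _ refl) (chain _ _ _ ())
zigzag-injective (first _ refl) (last _ ())
zigzag-injective (chain _ _ _ refl) (first _ ())
zigzag-injective (chain t _ refl refl) (chain t' _ refl e) =
  cong (λ s → 1 + double s) (double-injective (+-cancelˡ-≡ 4 _ _ e))
zigzag-injective (chain t _ _ refl) (last _ e) = ⊥-elim (double≢odd (+-cancelˡ-≡ 4 _ _ e))
zigzag-injective (last _ refl) (first _ ())
zigzag-injective (last _ refl) (chain t _ _ e) = ⊥-elim (double≢odd (+-cancelˡ-≡ 4 _ _ (sym e)))
zigzag-injective (last refl refl) (last refl _) = refl

opener-shape : ZigzagArc m x y → x ≡ 0 ⊎ ∃ λ k → x ≡ suc (double k)
opener-shape (first e _) = inj₁ e
opener-shape (chain t _ e _) = inj₂ (t , e)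
opener-shape {m} (last e _) = inj₂ (suc m , e)

closer-shape : ZigzagArc m x y → (∃ λ k → k ≤ suc m × y ≡ double (suc k)) ⊎ y ≡ 5 + double m
closer-shape (first _ e) = inj₁ (0 , z≤n , e)
closer-shape (chain t t≤m _ e) = inj₁ (suc t , s≤s t≤m , e)
closer-shape (last _ e) = inj₂ e

zigzag-disjoint : ZigzagArc m x y → ¬ ZigzagArc m z x
zigzag-disjoint r r' with closer-shape r'
zigzag-disjoint (first refl _) _ | inj₁ (_ , _ , ())
zigzag-disjoint (first refl _) _ | inj₂ ()
zigzag-disjoint (chain t _ refl _) _ | inj₁ (_ , _ , e) = double≢odd (sym e)
zigzag-disjoint (chain t t≤m refl _) _ | inj₂ e =
  <-irrefl e (<-trans (chain-opener-< t≤m) (n≤1+n _))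
zigzag-disjoint (last refl _) _ | inj₁ (_ , _ , e) = double≢odd (sym e)
zigzag-disjoint (last refl _) _ | inj₂ e = m≢1+n+m _ {1} e

zigzag-covering : x < 6 + double m → ∃ (ZigzagArc m x) ⊎ ∃ λ z → ZigzagArc m z x
zigzag-covering {x} {m} x<n with parity x
... | even zero = inj₁ (2 , first refl refl)
... | even (suc zero) = inj₂ (0 , first refl refl)
... | even (suc (suc h)) = inj₂ (_ , chain h h≤m refl refl)
  where
  h≤m : h ≤ m
  h≤m = ≤-pred (double-cancel-< {b = suc m} (≤-pred (≤-pred (≤-pred (≤-pred x<n)))))
... | odd h with m≤n⇒m<n∨m≡n (≤-pred (double-cancel-< {h} {3 + m} (<-trans (n<1+n _) x<n)))
... | inj₂ refl = inj₂ (_ , last refl refl)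
... | inj₁ (s≤s h≤m+1) with m≤n⇒m<n∨m≡n h≤m+1
... | inj₁ (s≤s h≤m) = inj₁ (_ , chain h h≤m refl refl)
... | inj₂ refl = inj₁ (_ , last refl refl)

zigzag-non-nesting : ZigzagArc m x y → ZigzagArc m x' y' → x < x' → y < y'
zigzag-non-nesting (first refl _) (first refl _) ()
zigzag-non-nesting (first _ refl) (chain _ _ _ refl) _ = s≤s (s≤s (s≤s z≤n))
zigzag-non-nesting (first _ refl) (last _ refl) _ = s≤s (s≤s (s≤s z≤n))
zigzag-non-nesting (chain _ _ refl _) (first refl _) ()
zigzag-non-nesting (chain t _ refl refl) (chain t' _ refl refl) lt =
  +-monoʳ-< 4 (double-mono-< (double-cancel-< (≤-pred lt)))
zigzag-non-nesting (chain t t≤m _ refl) (last _ refl) _ = chain-closer-< t≤m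
zigzag-non-nesting (last refl _) (first refl _) ()
zigzag-non-nesting (last refl _) (chain t' t'≤m refl _) lt =
  ⊥-elim (<-asym lt (chain-opener-< t'≤m))
zigzag-non-nesting (last refl _) (last refl _) lt = ⊥-elim (<-irrefl refl lt)

adjacent-openers : ZigzagArc m a y → ZigzagArc m (suc a) y' → a ≡ 0
adjacent-openers r r' with opener-shape r | opener-shape r'
... | inj₁ a≡0 | _ = a≡0
... | inj₂ (k , refl) | inj₁ ()
... | inj₂ (k , refl) | inj₂ (k' , e) = ⊥-elim (double≢odd (sym (suc-injective e)))

adjacent-closers : ZigzagArc m y a → ZigzagArc m y' (suc a) → a ≡ 4 + double m
adjacent-closers {m = m} r r' with closer-shape r | closer-shape r'
... | inj₁ (k , _ , refl) | inj₁ (k' , _ , e) = ⊥-elim (double≢odd (sym e))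
... | inj₁ (k , _ , refl) | inj₂ e = suc-injective e
... | inj₂ refl | inj₁ (k' , k'≤m+1 , e) =
  ⊥-elim (1+n≰n (subst (_≤ suc _) k'≡m+2 k'≤m+1))
  where
  k'≡m+2 : k' ≡ suc (suc m)
  k'≡m+2 = sym (double-injective (suc-injective (suc-injective e)))
... | inj₂ refl | inj₂ e = ⊥-elim (m≢1+n+m _ {0} (sym e))

arc-into-2+2m : ∀ m → ∃ λ z → ZigzagArc m z (2 + double m)
arc-into-2+2m zero = 0 , first refl refl
arc-into-2+2m (suc k) = _ , chain k (n≤1+n k) refl refl

arc-from-3 : ∀ m → ∃ (ZigzagArc m 3)
arc-from-3 zero = _ , last refl refl
arc-from-3 (suc k) = _ , chain 1 (s≤s z≤n) refl refl

module Zigzag (m : ℕ) where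

  size : ℕ
  size = 6 + double m

  matching : Matching size
  matching = record
    { Arc = ZigzagArc m
    ; in-range = zigzag-in-range
    ; functional = zigzag-functional
    ; injective = zigzag-injective
    ; disjoint = zigzag-disjoint
    ; covering = zigzag-covering
    }

  open Involution matching

  -- At the same-direction pair (2m+4, 2m+5), with partners 2m+1 and 2m+3, the
  -- escape is v = 2m+2, whose partner lies further left.
  left-escape : ∀ {a} → 1 ≤ a → LeftEscape a
  left-escape _ (inj₁ r) (inj₂ r') = left-escape-opener-closer zigzag-long r r'
  left-escape _ (inj₂ r) (inj₁ r') = left-escape-closer-opener zigzag-long r r'
  left-escape 1≤a (inj₁ r) (inj₁ r') = ⊥-elim (<⇒≢ 1≤a (sym (adjacent-openers r r')))
  left-escape _ (inj₂ r) (inj₂ r') with adjacent-closers r r'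
  ... | refl with zigzag-injective r (chain m ≤-refl refl refl) | zigzag-injective r' (last refl refl)
  ... | refl | refl with arc-into-2+2m m
  ... | u , r'' =
    _ , u , inj₂ r'' , ≤-trans (n≤1+n _) (≤-trans (zigzag-long r'') (m≤n+m _ 2)) ,
    inj₁ (n≤1+n _ , n≤1+n _)

  -- At the same-direction pair (0, 1), with partners 2 and 4, the escape is
  -- v = 3, a left end.
  right-escape : ∀ {p} → 2 + p < size → RightEscape p
  right-escape _ (inj₁ r) (inj₂ r') = right-escape-opener-closer zigzag-long r r'
  right-escape _ (inj₂ r) (inj₁ r') = right-escape-closer-opener zigzag-long r r'
  right-escape _ (inj₁ r) (inj₁ r') with adjacent-openers r r'
  ... | refl with zigzag-functional r (first refl refl) | zigzag-functional r' (chain 0 z≤n refl refl)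
  ... | refl | refl with arc-from-3 m
  ... | u , r'' =
    3 , u , inj₁ r'' , ≤-trans (s≤s (s≤s z≤n)) (zigzag-long r'') ,
    inj₁ (s≤s (s≤s z≤n) , s≤s (s≤s (s≤s z≤n)))
  right-escape p+2<n (inj₂ r) (inj₂ r') with adjacent-closers r r'
  ... | refl = ⊥-elim (<-irrefl refl p+2<n)

  simple-I321 : Σ (Perm size) SimpleI321
  simple-I321 = π , π-involution , avoids321 zigzag-non-nesting , simple left-escape right-escape

proposition2p5 : ∀ (N : ℕ) → ∃ λ (n : ℕ) → n ≥ N × Σ (Perm n) SimpleI321
proposition2p5 N = Zigzag.size N , m≤n⇒m≤o+n 6 (n≤double N) , Zigzag.simple-I321 N
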